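{- Let $I$ be a linearly ordered set and $\{P_i: i\in I\}$ a family of pairwise disjoint associative posets. Then the ordered sum $\sum_{i\in I}P_i$ is associative.
   Context: A binary operation $\cdot$ on a poset $(P,\leq)$ is admissible if for all $x,y\in P$: $x\leq y\iff x\cdot y=x$. A right-regular band (RRB) is a set with an associative binary operation satisfying $x\cdot x=x$ and $x\cdot y\cdot x=y\cdot x$. A poset is associative if it admits an admissible RRB operation. The ordered sum $\sum_{i\in I}P_i$ is the poset on $\bigsqcup_{i\in I}P_i$ in which $x\leq y$ iff either $x,y\in P_i$ for the same $i$ and $x\leq y$ in $P_i$, or $x\in P_i$, $y\in P_j$ with $i<j$. -}

module Defs where

open import Level using (Level; _⊔_; suc)
open import Data.Product using (Σ; ∃; _×_; _,_; proj₁; proj₂)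
open import Data.Sum using (_⊎_)
open import Data.Empty using (⊥-elim)
open import Relation.Binary.PropositionalEquality using (_≡_; refl; cong; isEquivalence)
open import Relation.Binary.Core using (Rel)
open import Relation.Binary.Structures using (IsPartialOrder; IsStrictTotalOrder)
open import Function.Bundles using (_⇔_)

record PosetOn {c : Level} (A : Set c) (ℓ : Level) : Set (c ⊔ suc ℓ) where
  field
    _≤_ : Rel A ℓ
    isPartialOrder : IsPartialOrder _≡_ _≤_

record Poset' (c ℓ : Level) : Set (suc (c ⊔ ℓ)) where
  field
    Carrier : Set c
    posetOn : PosetOn Carrier ℓ
  open PosetOn posetOn public

Admissible : ∀ {c ℓ} {A : Set c} → Rel A ℓ → (A → A → A) → Set (c ⊔ ℓ)
Admissible {A = A} _≤_ _·_ = ∀ (x y : A) → (x ≤ y) ⇔ ((x · y) ≡ x)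

IsRRB : ∀ {c} {A : Set c} → (A → A → A) → Set c
IsRRB {A = A} _·_ =
  (∀ (x y z : A) → ((x · y) · z) ≡ (x · (y · z))) ×
  (∀ (x : A) → (x · x) ≡ x) ×
  (∀ (x y : A) → ((x · y) · x) ≡ (y · x))

Associative : ∀ {c ℓ} → Poset' c ℓ → Set (c ⊔ ℓ)
Associative P = Σ (Carrier → Carrier → Carrier) λ _·_ → IsRRB _·_ × Admissible _≤_ _·_
  where open Poset' P

-- ordered sum of a family of posets indexed by a strictly-ordered index set.
-- The disjoint union is the Σ-type, so the summands are disjoint by construction.
data SumLeq {i c ℓ r : Level} {I : Set i} (_<_ : Rel I r) (P : I → Poset' c ℓ)
     : Rel (Σ I (λ i → Poset'.Carrier (P i))) (i ⊔ c ⊔ ℓ ⊔ r) where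
  same : ∀ {i} {x y : Poset'.Carrier (P i)} → Poset'._≤_ (P i) x y → SumLeq _<_ P (i , x) (i , y)
  lt   : ∀ {i j} {x : Poset'.Carrier (P i)} {y : Poset'.Carrier (P j)} → i < j → SumLeq _<_ P (i , x) (j , y)

module _ {i c ℓ r : Level} {I : Set i} {_<_ : Rel I r}
         (sto : IsStrictTotalOrder _≡_ _<_) (P : I → Poset' c ℓ) where
  private
    module S = IsStrictTotalOrder sto
    module Q (k : I) = IsPartialOrder (Poset'.isPartialOrder (P k))
    C = Σ I (λ k → Poset'.Carrier (P k))

  sumRefl : ∀ {x y : C} → x ≡ y → SumLeq _<_ P x y
  sumRefl {k , x} refl = same (Q.reflexive k refl)

  sumTrans : ∀ {x y z : C} → SumLeq _<_ P x y → SumLeq _<_ P y z → SumLeq _<_ P x z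
  sumTrans {k , _} (same p) (same q) = same (Q.trans k p q)
  sumTrans (same p) (lt q) = lt q
  sumTrans (lt p) (same q) = lt p
  sumTrans (lt p) (lt q) = lt (S.trans p q)

  sumAntisym : ∀ {x y : C} → SumLeq _<_ P x y → SumLeq _<_ P y x → x ≡ y
  sumAntisym {k , _} (same p) (same q) = cong (k ,_) (Q.antisym k p q)
  sumAntisym (same p) (lt q) = ⊥-elim (S.irrefl refl q)
  sumAntisym (lt p) (same q) = ⊥-elim (S.irrefl refl p)
  sumAntisym (lt p) (lt q) = ⊥-elim (S.irrefl refl (S.trans p q))

  OrderedSum : Poset' (i ⊔ c) (i ⊔ c ⊔ ℓ ⊔ r)
  OrderedSum = record
    { Carrier = C
    ; posetOn = record
      { _≤_ = SumLeq _<_ P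
      ; isPartialOrder = record
        { isPreorder = record
          { isEquivalence = isEquivalence
          ; reflexive = sumRefl
          ; trans = sumTrans }
        ; antisym = sumAntisym } } }

{-# OPTIONS --safe #-}
module Submission where

open import Defs
open import Level using (Level)
open import Data.Product using (Σ; _,_; proj₁; proj₂)
open import Data.Product.Properties using (,-injectiveˡ; ,-injectiveʳ-UIP)
open import Relation.Binary.PropositionalEquality
  using (_≡_; refl; sym; trans; cong; module ≡-Reasoning)
open import Relation.Binary.Core using (Rel)
open import Relation.Binary.Structures using (IsStrictTotalOrder)
open import Relation.Binary.Definitions using (Tri; tri<; tri≈; tri>)
open import Relation.Nullary using (¬_; contradiction)
open import Axiom.UniquenessOfIdentityProofs using (module Decidable⇒UIP)
open import Algebra.Core using (Op₂)
import Algebra.Definitions as Alg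
open import Function.Base using (_∘_)
open import Function.Bundles using (mk⇔; module Equivalence)

-- Proof idea: let an element of a lower summand absorb any element of a higher one, and
-- multiply inside a summand by its own operation. As soon as two of the indices involved
-- differ, a product is decided by comparing indices alone, so the laws of the summands
-- are needed only within one summand.

RightRegular : ∀ {c} {A : Set c} → Op₂ A → Set c
RightRegular _∙_ = ∀ x y → (x ∙ y) ∙ x ≡ y ∙ x

module OrdinalSum {a r c} {I : Set a} {_<_ : Rel I r} (sto : IsStrictTotalOrder _≡_ _<_)
                  {A : I → Set c} (_∙_ : ∀ {i} → Op₂ (A i)) where

  open IsStrictTotalOrder sto using (compare; irrefl; asym) renaming (trans to <-trans)
  open ≡-Reasoning

  infixl 7 _·_
  _·_ : Op₂ (Σ I A)
  (i , x) · (j , y) with compare i j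
  ... | tri< _ _ _    = i , x
  ... | tri≈ _ refl _ = i , x ∙ y
  ... | tri> _ _ _    = j , y

  ·-< : ∀ {i j} (x : A i) (y : A j) → i < j → (i , x) · (j , y) ≡ (i , x)
  ·-< {i} {j} x y i<j with compare i j
  ... | tri< _ _ _     = refl
  ... | tri≈ i≮j _ _   = contradiction i<j i≮j
  ... | tri> i≮j _ _   = contradiction i<j i≮j

  ·-> : ∀ {i j} (x : A i) (y : A j) → j < i → (i , x) · (j , y) ≡ (j , y)
  ·-> {i} {j} x y j<i with compare i j
  ... | tri< _ _ j≮i   = contradiction j<i j≮i
  ... | tri≈ _ _ j≮i   = contradiction j<i j≮i
  ... | tri> _ _ _     = refl

  ·-≡ : ∀ {i} (x y : A i) → (i , x) · (i , y) ≡ (i , x ∙ y)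
  ·-≡ {i} x y with compare i i
  ... | tri< _ i≢i _   = contradiction refl i≢i
  ... | tri≈ _ refl _  = refl
  ... | tri> _ i≢i _   = contradiction refl i≢i

  skip-middleˡ : ∀ {i j k} (x : A i) (y : A j) (z : A k) → i < j →
                 (i , x) · ((j , y) · (k , z)) ≡ (i , x) · (k , z)
  skip-middleˡ {i} {j} {k} x y z i<j with compare j k
  ... | tri< j<k _ _   = trans (·-< x y i<j) (sym (·-< x z (<-trans i<j j<k)))
  ... | tri≈ _ refl _  = trans (·-< x (y ∙ z) i<j) (sym (·-< x z i<j))
  ... | tri> _ _ _     = refl

  skip-middleʳ : ∀ {i j k} (x : A i) (y : A j) (z : A k) → k < j →
                 ((i , x) · (j , y)) · (k , z) ≡ (i , x) · (k , z)
  skip-middleʳ {i} {j} {k} x y z k<j with compare i j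
  ... | tri< _ _ _     = refl
  ... | tri≈ _ refl _  = trans (·-> (x ∙ y) z k<j) (sym (·-> x z k<j))
  ... | tri> _ _ j<i   = trans (·-> y z k<j) (sym (·-> x z (<-trans k<j j<i)))

  ·-assoc-within : ∀ {i} → Alg.Associative _≡_ (_∙_ {i}) → (x y z : A i) →
                   (i , x) · (i , y) · (i , z) ≡ (i , x) · ((i , y) · (i , z))
  ·-assoc-within {i} ∙-assoc x y z = begin
    (i , x) · (i , y) · (i , z)       ≡⟨ cong (_· (i , z)) (·-≡ x y) ⟩
    (i , x ∙ y) · (i , z)             ≡⟨ ·-≡ (x ∙ y) z ⟩
    (i , (x ∙ y) ∙ z)                 ≡⟨ cong (i ,_) (∙-assoc x y z) ⟩
    (i , x ∙ (y ∙ z))                 ≡⟨ ·-≡ x (y ∙ z) ⟨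
    (i , x) · (i , y ∙ z)             ≡⟨ cong ((i , x) ·_) (·-≡ y z) ⟨
    (i , x) · ((i , y) · (i , z))     ∎

  ·-assoc : (∀ i → Alg.Associative _≡_ (_∙_ {i})) → Alg.Associative _≡_ _·_
  ·-assoc ∙-assoc (i , x) (j , y) (k , z) = by-cases (compare i j) (compare j k)
    where
    by-cases : Tri (i < j) (i ≡ j) (j < i) → Tri (j < k) (j ≡ k) (k < j) →
               (i , x) · (j , y) · (k , z) ≡ (i , x) · ((j , y) · (k , z))
    by-cases (tri< i<j _ _) _ = begin
      (i , x) · (j , y) · (k , z)       ≡⟨ cong (_· (k , z)) (·-< x y i<j) ⟩
      (i , x) · (k , z)                 ≡⟨ skip-middleˡ x y z i<j ⟨
      (i , x) · ((j , y) · (k , z))     ∎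
    by-cases _ (tri> _ _ k<j) = begin
      (i , x) · (j , y) · (k , z)       ≡⟨ skip-middleʳ x y z k<j ⟩
      (i , x) · (k , z)                 ≡⟨ cong ((i , x) ·_) (·-> y z k<j) ⟨
      (i , x) · ((j , y) · (k , z))     ∎
    by-cases (tri≈ _ refl _) (tri≈ _ refl _) = ·-assoc-within (∙-assoc i) x y z
    by-cases (tri≈ _ refl _) (tri< j<k _ _) = begin
      (i , x) · (i , y) · (k , z)       ≡⟨ cong (_· (k , z)) (·-≡ x y) ⟩
      (i , x ∙ y) · (k , z)             ≡⟨ ·-< (x ∙ y) z j<k ⟩
      (i , x ∙ y)                       ≡⟨ ·-≡ x y ⟨
      (i , x) · (i , y)                 ≡⟨ cong ((i , x) ·_) (·-< y z j<k) ⟨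
      (i , x) · ((i , y) · (k , z))     ∎
    by-cases (tri> _ _ j<i) (tri≈ _ refl _) = begin
      (i , x) · (j , y) · (j , z)       ≡⟨ cong (_· (j , z)) (·-> x y j<i) ⟩
      (j , y) · (j , z)                 ≡⟨ ·-≡ y z ⟩
      (j , y ∙ z)                       ≡⟨ ·-> x (y ∙ z) j<i ⟨
      (i , x) · (j , y ∙ z)             ≡⟨ cong ((i , x) ·_) (·-≡ y z) ⟨
      (i , x) · ((j , y) · (j , z))     ∎
    by-cases (tri> _ _ j<i) (tri< j<k _ _) = begin
      (i , x) · (j , y) · (k , z)       ≡⟨ cong (_· (k , z)) (·-> x y j<i) ⟩
      (j , y) · (k , z)                 ≡⟨ ·-< y z j<k ⟩
      (j , y)                           ≡⟨ ·-> x y j<i ⟨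
      (i , x) · (j , y)                 ≡⟨ cong ((i , x) ·_) (·-< y z j<k) ⟨
      (i , x) · ((j , y) · (k , z))     ∎

  ·-idem : (∀ i → Alg.Idempotent _≡_ (_∙_ {i})) → Alg.Idempotent _≡_ _·_
  ·-idem ∙-idem (i , x) = trans (·-≡ x x) (cong (i ,_) (∙-idem i x))

  ·-rightRegular : (∀ i → Alg.Idempotent _≡_ (_∙_ {i})) → (∀ i → RightRegular (_∙_ {i})) →
                   RightRegular _·_
  ·-rightRegular ∙-idem ∙-rightRegular (i , x) (j , y) with compare i j
  ... | tri< i<j _ _  = trans (·-idem ∙-idem (i , x)) (sym (·-> y x i<j))
  ... | tri≈ _ refl _ = begin
    (i , x ∙ y) · (i , x)   ≡⟨ ·-≡ (x ∙ y) x ⟩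
    (i , (x ∙ y) ∙ x)       ≡⟨ cong (i ,_) (∙-rightRegular i x y) ⟩
    (i , y ∙ x)             ≡⟨ ·-≡ y x ⟨
    (i , y) · (i , x)       ∎
  ... | tri> _ _ _    = refl

module _ {a r c ℓ} {I : Set a} {_<_ : Rel I r} (sto : IsStrictTotalOrder _≡_ _<_)
         (P : I → Poset' c ℓ) (_∙_ : ∀ {i} → Op₂ (Poset'.Carrier (P i))) where

  open IsStrictTotalOrder sto using (compare; irrefl; asym; _≟_)
  open Poset' using (Carrier; _≤_)
  open OrdinalSum sto {A = λ i → Carrier (P i)} _∙_ using (_·_)

  SumLeq⇒≯ : ∀ {i j x y} → SumLeq _<_ P (i , x) (j , y) → ¬ (j < i)
  SumLeq⇒≯ (same _) = irrefl refl
  SumLeq⇒≯ (lt i<j) = asym i<j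

  SumLeq⇒≤ : ∀ {i} {x y : Carrier (P i)} → SumLeq _<_ P (i , x) (i , y) → _≤_ (P i) x y
  SumLeq⇒≤ (same x≤y) = x≤y
  SumLeq⇒≤ (lt i<i)   = contradiction i<i (irrefl refl)

  ·-admissible : (∀ i → Admissible (_≤_ (P i)) (_∙_ {i})) → Admissible (SumLeq _<_ P) _·_
  ·-admissible ∙-admissible (i , x) (j , y) with compare i j
  ... | tri< i<j _ _  = mk⇔ (λ _ → refl) (λ _ → lt i<j)
  ... | tri≈ _ refl _ = mk⇔ (cong (i ,_) ∘ to ∘ SumLeq⇒≤)
                            (same ∘ from ∘ ,-injectiveʳ-UIP (Decidable⇒UIP.≡-irrelevant _≟_))
    where open Equivalence (∙-admissible i x y)
  ... | tri> _ _ j<i  = mk⇔ (λ u≤v → contradiction j<i (SumLeq⇒≯ u≤v))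
                            (λ v≡u → contradiction j<i (irrefl (,-injectiveˡ v≡u)))

lemma4p1 : ∀ {a r c ℓ : Level} (I : Set a) (_<_ : Rel I r) (sto : IsStrictTotalOrder _≡_ _<_) →
    (P : I → Poset' c ℓ) → (∀ i → Associative (P i)) →
    Associative (OrderedSum sto P)
lemma4p1 I _<_ sto P associative =
    _·_
  , (·-assoc ∙-assoc , ·-idem ∙-idem , ·-rightRegular ∙-idem ∙-rightRegular)
  , ·-admissible sto P _∙_ ∙-admissible
  where
  _∙_ : ∀ {i} → Op₂ (Poset'.Carrier (P i))
  _∙_ {i} = proj₁ (associative i)

  ∙-assoc : ∀ i → Alg.Associative _≡_ (_∙_ {i})
  ∙-assoc i = proj₁ (proj₁ (proj₂ (associative i)))

  ∙-idem : ∀ i → Alg.Idempotent _≡_ (_∙_ {i})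
  ∙-idem i = proj₁ (proj₂ (proj₁ (proj₂ (associative i))))

  ∙-rightRegular : ∀ i → RightRegular (_∙_ {i})
  ∙-rightRegular i = proj₂ (proj₂ (proj₁ (proj₂ (associative i))))

  ∙-admissible : ∀ i → Admissible (Poset'._≤_ (P i)) (_∙_ {i})
  ∙-admissible i = proj₂ (proj₂ (associative i))

  open OrdinalSum sto _∙_
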